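{- Let $n\ge 1$ and let $q$ be a product of $k\ge1$ pairwise distinct primes. Then $\mathrm{DI}(\mathbf{NEQ}_n,q)=\lceil n/k\rceil$.
   Context: For a predicate $P:\mathcal X\times\mathcal Y\to\{0,1\}$ (finite sets) and integer $q\ge2$, an inner product encoding of $P$ modulo $q$ of length $\ell$ is a pair of maps $x\mapsto \vec x\in\mathbb Z_q^\ell$, $y\mapsto\vec y\in\mathbb Z_q^\ell$ such that for all $x,y$: $P(x,y)=1$ iff $\sum_{i=1}^\ell\vec x_i\vec y_i\equiv0\pmod q$; $\mathrm{DI}(P,q)$ is the minimum such $\ell$. The inequality predicate $\mathbf{NEQ}_n:[n]\times[n]\to\{0,1\}$ is $\mathbf{NEQ}_n(x,y)=1$ iff $x\ne y$. -}

module Defs where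

open import Data.Nat using (ℕ; zero; suc; _+_; _*_; _≤_)
open import Data.Nat.DivMod using (_/_)
open import Data.Nat.Divisibility using (_∣_)
open import Data.Nat.Primality using (Prime)
open import Data.Fin using (Fin; toℕ)
open import Data.Bool using (Bool; true; false)
open import Data.List using (List; length)
open import Data.Nat.ListAction using (product)
open import Data.List.Relation.Unary.All using (All)
open import Data.List.Relation.Unary.Unique.Propositional using (Unique)
open import Data.Product using (Σ; ∃; _×_)
open import Function.Bundles using (_⇔_)
open import Relation.Binary.PropositionalEquality using (_≡_; _≢_)
open import Relation.Nullary using (¬_; Dec; yes; no)
open import Relation.Nullary.Decidable using (⌊_⌋; ¬?)
import Data.Fin as F

sumFin : (ℓ : ℕ) → (Fin ℓ → ℕ) → ℕ
sumFin zero    f = 0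
sumFin (suc ℓ) f = f F.zero + sumFin ℓ (λ i → f (F.suc i))

-- inner product of two vectors in Z_q^ℓ (entries as representatives 0..q-1), computed in ℕ
innerProduct : {q ℓ : ℕ} → (Fin ℓ → Fin q) → (Fin ℓ → Fin q) → ℕ
innerProduct {q} {ℓ} u v = sumFin ℓ (λ i → toℕ (u i) * toℕ (v i))

record IPEncoding {X Y : Set} (P : X → Y → Bool) (q ℓ : ℕ) : Set where
  field
    encX : X → (Fin ℓ → Fin q)
    encY : Y → (Fin ℓ → Fin q)
    correct : ∀ x y → (P x y ≡ true) ⇔ (q ∣ innerProduct (encX x) (encY y))

IsDI : {X Y : Set} → (X → Y → Bool) → ℕ → ℕ → Set
IsDI P q d = IPEncoding P q d × (∀ ℓ → IPEncoding P q ℓ → d ≤ ℓ)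

NEQ : (n : ℕ) → Fin n → Fin n → Bool
NEQ n x y = ⌊ ¬? (x F.≟ y) ⌋

-- ⌈ n / k ⌉  (k ≥ 1 ; value at k = 0 is irrelevant)
ceilDiv : ℕ → ℕ → ℕ
ceilDiv n zero    = 0
ceilDiv n (suc k) = (n + k) / suc k

ProductOfDistinctPrimes : ℕ → ℕ → Set
ProductOfDistinctPrimes q k =
  Σ (List ℕ) λ ps → (length ps ≡ k) × All Prime ps × Unique ps × (product ps ≡ q)

-- Upper bound: for q = p₁ ⋯ pₖ the cofactors cⱼ = q / pⱼ satisfy q ∣ cⱼ cⱼ′ for j ≢ j′ but q ∤ cⱼ²,
-- so each of ⌈n/k⌉ coordinates can carry k inputs, encoded as the vectors cⱼ eᵢ.
-- Lower bound: given an encoding of length ℓ and a prime p ∣ q, the inputs x with p ∤ ⟨x⃗, y⃗ₓ⟩ have a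
-- diagonal invertible Gram matrix over 𝔽ₚ, so there are at most ℓ of them; since q is squarefree every
-- input is such an x for some p, hence n ≤ kℓ.
module Submission where

open import Defs
open import Data.Nat using (ℕ; zero; suc; _+_; _*_; _∸_; _≤_; _<_; z≤n; s≤s; s≤s⁻¹; NonZero; nonTrivial⇒≢1; nonTrivial⇒n>1)
open import Data.Nat.Properties
open import Data.Nat.Divisibility
open import Data.Nat.Primality
open import Data.Nat.DivMod
open import Algebra.Properties.CommutativeSemigroup +-commutativeSemigroup using (x∙yz≈y∙xz)
open import Data.Nat.ListAction using (product)
open import Data.Nat.ListAction.Properties using (∈⇒∣product)
open import Data.Nat.Tactic.RingSolver using (solve-∀)
open import Data.Fin as F using (Fin; toℕ; punchIn)
import Data.Fin.Properties as FP
open import Data.Bool using (true; false)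
open import Data.List using (List; []; _∷_; length; lookup; filter)
import Data.List.Properties as List
open import Data.List.Membership.Propositional using (_∈_)
open import Data.List.Membership.Propositional.Properties using (∈-lookup; ∈-filter⁻)
open import Data.List.Relation.Unary.All as All using (All; []; _∷_)
open import Data.List.Relation.Unary.All.Properties using (¬All⇒Any¬; All¬⇒¬Any)
open import Data.List.Relation.Unary.Any as Any using (Any; here; there)
import Data.List.Relation.Unary.AllPairs as AllPairs
open import Data.List.Relation.Unary.Unique.Propositional using (Unique; []; _∷_)
import Data.List.Relation.Unary.Unique.Propositional.Properties as Unique
open import Data.Product using (_,_; proj₁; proj₂; ∃; _×_; uncurry)
open import Data.Sum using (inj₁; inj₂; reduce)
open import Function using (id; _∘_; _$_)
open import Function.Bundles using (_⇔_; mk⇔; Equivalence)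
open import Relation.Binary.PropositionalEquality
open import Relation.Nullary using (yes; no; does; ¬?; contradiction)
open import Relation.Unary using (Decidable)
open import Relation.Unary.Properties using (∁?)

sumFin-cong : ∀ ℓ {f g : Fin ℓ → ℕ} → (∀ t → f t ≡ g t) → sumFin ℓ f ≡ sumFin ℓ g
sumFin-cong zero    f≗g = refl
sumFin-cong (suc ℓ) f≗g = cong₂ _+_ (f≗g F.zero) (sumFin-cong ℓ (f≗g ∘ F.suc))

sumFin-zero : ∀ ℓ → sumFin ℓ (λ _ → 0) ≡ 0
sumFin-zero zero    = refl
sumFin-zero (suc ℓ) = sumFin-zero ℓ

sumFin-punchIn : ∀ {ℓ} (t : Fin (suc ℓ)) (f : Fin (suc ℓ) → ℕ) →
                 sumFin (suc ℓ) f ≡ f t + sumFin ℓ (f ∘ punchIn t)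
sumFin-punchIn             F.zero    f = refl
sumFin-punchIn {suc ℓ}     (F.suc t) f = begin
  f F.zero + sumFin (suc ℓ) (f ∘ F.suc)
    ≡⟨ cong (f F.zero +_) (sumFin-punchIn t (f ∘ F.suc)) ⟩
  f F.zero + (f (F.suc t) + rest)
    ≡⟨ x∙yz≈y∙xz (f F.zero) (f (F.suc t)) rest ⟩
  f (F.suc t) + (f F.zero + rest) ∎
  where
  open ≡-Reasoning
  rest = sumFin ℓ (f ∘ F.suc ∘ punchIn t)

∣-sumFin : ∀ ℓ {d} {f : Fin ℓ → ℕ} → (∀ t → d ∣ f t) → d ∣ sumFin ℓ f
∣-sumFin zero    {d} d∣f = d ∣0
∣-sumFin (suc ℓ)     d∣f = ∣m∣n⇒∣m+n (d∣f F.zero) (∣-sumFin ℓ (d∣f ∘ F.suc))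

infixl 7 _·_

_·_ : ∀ {ℓ} → (Fin ℓ → ℕ) → (Fin ℓ → ℕ) → ℕ
_·_ {ℓ} x y = sumFin ℓ (λ t → x t * y t)

·-linearˡ : ∀ {ℓ} α β (x y z : Fin ℓ → ℕ) →
            (λ t → α * x t + β * y t) · z ≡ α * (x · z) + β * (y · z)
·-linearˡ {zero}  α β x y z = sym (cong₂ _+_ (*-zeroʳ α) (*-zeroʳ β))
·-linearˡ {suc ℓ} α β x y z = begin
  (α * x₀ + β * y₀) * z₀ + (λ t → α * x (F.suc t) + β * y (F.suc t)) · (z ∘ F.suc)
    ≡⟨ cong ((α * x₀ + β * y₀) * z₀ +_) (·-linearˡ α β (x ∘ F.suc) (y ∘ F.suc) (z ∘ F.suc)) ⟩
  (α * x₀ + β * y₀) * z₀ + (α * ((x ∘ F.suc) · (z ∘ F.suc)) + β * ((y ∘ F.suc) · (z ∘ F.suc)))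
    ≡⟨ distribute α β x₀ y₀ z₀ _ _ ⟩
  α * (x · z) + β * (y · z) ∎
  where
  open ≡-Reasoning
  x₀ = x F.zero
  y₀ = y F.zero
  z₀ = z F.zero
  distribute : ∀ α β a b c X Y → (α * a + β * b) * c + (α * X + β * Y) ≡ α * (a * c + X) + β * (b * c + Y)
  distribute = solve-∀

∃-∤-entry : ∀ {ℓ} {d} (x z : Fin ℓ → ℕ) → d ∤ x · z → ∃ λ t → d ∤ x t
∃-∤-entry {ℓ} {d} x z d∤x·z =
  FP.¬∀⟶∃¬ ℓ (λ t → d ∣ x t) (λ t → d ∣? x t)
    (λ d∣x → d∤x·z (∣-sumFin ℓ (λ t → ∣m⇒∣m*n (z t) (d∣x t))))

a*b+[p∸1]*b*a≡p*[a*b] : ∀ p .{{_ : NonZero p}} a b → a * b + (p ∸ 1) * b * a ≡ p * (a * b)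
a*b+[p∸1]*b*a≡p*[a*b] (suc p′) = cancel p′
  where
  cancel : ∀ p′ a b → a * b + p′ * b * a ≡ suc p′ * (a * b)
  cancel = solve-∀

module Elimination {p} (p-prime : Prime p) {ℓ} (x : Fin (suc ℓ) → ℕ) (t : Fin (suc ℓ)) where

  private instance
    p≢0 : NonZero p
    p≢0 = prime⇒nonZero p-prime

  -- Row reduction modulo p against the pivot x t, with p ∸ 1 standing for -1.
  combination : (Fin (suc ℓ) → ℕ) → Fin (suc ℓ) → ℕ
  combination y s = x t * y s + (p ∸ 1) * y t * x s

  eliminate : (Fin (suc ℓ) → ℕ) → Fin ℓ → ℕ
  eliminate y = combination y ∘ punchIn t

  combination-pivot : ∀ y → combination y t ≡ p * (x t * y t)
  combination-pivot y = a*b+[p∸1]*b*a≡p*[a*b] p (x t) (y t)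

  eliminate-· : ∀ y z → p * (x t * y t) * z t + eliminate y · (z ∘ punchIn t)
                        ≡ x t * (y · z) + (p ∸ 1) * y t * (x · z)
  eliminate-· y z = begin
    p * (x t * y t) * z t + eliminate y · (z ∘ punchIn t)
      ≡⟨ cong (λ c → c * z t + eliminate y · (z ∘ punchIn t)) (combination-pivot y) ⟨
    combination y t * z t + eliminate y · (z ∘ punchIn t)
      ≡⟨ sumFin-punchIn t (λ s → combination y s * z s) ⟨
    combination y · z
      ≡⟨ ·-linearˡ (x t) ((p ∸ 1) * y t) y x z ⟩
    x t * (y · z) + (p ∸ 1) * y t * (x · z) ∎
    where open ≡-Reasoning

  eliminate-∣⇔ : p ∤ x t → ∀ y z → p ∣ x · z → (p ∣ eliminate y · (z ∘ punchIn t)) ⇔ (p ∣ y · z)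
  eliminate-∣⇔ p∤xₜ y z p∣x·z = mk⇔ to from
    where
    p∣pivot : p ∣ p * (x t * y t) * z t
    p∣pivot = ∣m⇒∣m*n (z t) (m∣m*n (x t * y t))
    p∣second : p ∣ (p ∸ 1) * y t * (x · z)
    p∣second = ∣n⇒∣m*n ((p ∸ 1) * y t) p∣x·z
    p∣sum : p ∣ eliminate y · (z ∘ punchIn t) → p ∣ x t * (y · z) + (p ∸ 1) * y t * (x · z)
    p∣sum p∣e = subst (p ∣_) (eliminate-· y z) (∣m∣n⇒∣m+n p∣pivot p∣e)
    to : p ∣ eliminate y · (z ∘ punchIn t) → p ∣ y · z
    to p∣e with euclidsLemma (x t) (y · z) p-prime
                  (∣m+n∣m⇒∣n (subst (p ∣_) (+-comm (x t * (y · z)) _) (p∣sum p∣e)) p∣second)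
    ... | inj₁ p∣xₜ = contradiction p∣xₜ p∤xₜ
    ... | inj₂ p∣y·z = p∣y·z
    from : p ∣ y · z → p ∣ eliminate y · (z ∘ punchIn t)
    from p∣y·z = ∣m+n∣m⇒∣n
      (subst (p ∣_) (sym (eliminate-· y z)) (∣m∣n⇒∣m+n (∣n⇒∣m*n (x t) p∣y·z) p∣second))
      p∣pivot

record Biorthogonal (p : ℕ) {I : Set} {ℓ} (u v : I → Fin ℓ → ℕ) (xs : List I) : Set where
  field
    unique       : Unique xs
    off-diagonal : ∀ {i j} → i ∈ xs → j ∈ xs → i ≢ j → p ∣ u i · v j
    diagonal     : ∀ {i} → i ∈ xs → p ∤ u i · v i

-- Gaussian elimination on a pivot entry of u x reduces the dimension and the system by one each.
biorthogonal⇒length≤dimension : ∀ {p} → Prime p → ∀ {I : Set} {ℓ} {u v : I → Fin ℓ → ℕ} {xs} →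
                                 Biorthogonal p u v xs → length xs ≤ ℓ
biorthogonal⇒length≤dimension p-prime {xs = []} _ = z≤n
biorthogonal⇒length≤dimension {p} p-prime {ℓ = ℓ} {u} {v} {x ∷ xs} b
  with ∃-∤-entry (u x) (v x) (Biorthogonal.diagonal b (here refl))
biorthogonal⇒length≤dimension {p} p-prime {ℓ = suc ℓ} {u} {v} {x ∷ xs} b | t , p∤xₜ =
  s≤s (biorthogonal⇒length≤dimension p-prime reduced)
  where
  open Biorthogonal b
  open Elimination p-prime (u x) t
  x∉xs : ∀ {j} → j ∈ xs → x ≢ j
  x∉xs = All.lookup (AllPairs.head unique)
  preserved : ∀ {i j} → j ∈ xs → (p ∣ eliminate (u i) · (v j ∘ punchIn t)) ⇔ (p ∣ u i · v j)
  preserved {i} {j} j∈xs = eliminate-∣⇔ p∤xₜ (u i) (v j) (off-diagonal (here refl) (there j∈xs) (x∉xs j∈xs))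
  reduced : Biorthogonal p (eliminate ∘ u) (λ j → v j ∘ punchIn t) xs
  reduced = record
    { unique       = AllPairs.tail unique
    ; off-diagonal = λ i∈xs j∈xs i≢j →
        Equivalence.from (preserved j∈xs) (off-diagonal (there i∈xs) (there j∈xs) i≢j)
    ; diagonal     = λ i∈xs → diagonal (there i∈xs) ∘ Equivalence.to (preserved i∈xs)
    }

length-filter+length-filter∁ : ∀ {A : Set} {P : A → Set} (P? : Decidable P) xs →
                               length (filter P? xs) + length (filter (∁? P?) xs) ≡ length xs
length-filter+length-filter∁ P? [] = refl
length-filter+length-filter∁ P? (x ∷ xs) with does (P? x)
... | true  = cong suc (length-filter+length-filter∁ P? xs)
... | false = trans (+-suc _ _) (cong suc (length-filter+length-filter∁ P? xs))

length≤primes*dimension : ∀ {I : Set} {ℓ} (u v : I → Fin ℓ → ℕ) {ps} → All Prime ps → ∀ {xs} → Unique xs →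
                          (∀ {i j} → i ∈ xs → j ∈ xs → i ≢ j → All (_∣ u i · v j) ps) →
                          (∀ {i} → i ∈ xs → Any (_∤ u i · v i) ps) →
                          length xs ≤ length ps * ℓ
length≤primes*dimension u v [] {[]} _ _ _ = z≤n
length≤primes*dimension u v [] {x ∷ xs} _ _ diagonal with () ← diagonal (here refl)
length≤primes*dimension {ℓ = ℓ} u v {p ∷ ps} (p-prime ∷ primes) {xs} unique off-diagonal diagonal = begin
  length xs                                   ≡⟨ length-filter+length-filter∁ p∤? xs ⟨
  length (filter p∤? xs) + length (filter (∁? p∤?) xs)
    ≤⟨ +-mono-≤ (biorthogonal⇒length≤dimension p-prime biorthogonal) rest ⟩
  ℓ + length ps * ℓ ∎
  where
  open ≤-Reasoning
  p∤? : Decidable (λ i → p ∤ u i · v i)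
  p∤? i = ¬? (p ∣? u i · v i)
  biorthogonal : Biorthogonal p u v (filter p∤? xs)
  biorthogonal = record
    { unique       = Unique.filter⁺ p∤? unique
    ; off-diagonal = λ i∈ j∈ i≢j →
        All.head (off-diagonal (proj₁ (∈-filter⁻ p∤? i∈)) (proj₁ (∈-filter⁻ p∤? j∈)) i≢j)
    ; diagonal     = proj₂ ∘ ∈-filter⁻ p∤? {xs = xs}
    }
  rest : length (filter (∁? p∤?) xs) ≤ length ps * ℓ
  rest = length≤primes*dimension u v primes (Unique.filter⁺ (∁? p∤?) unique)
    (λ i∈ j∈ i≢j → All.tail (off-diagonal (proj₁ (∈-filter⁻ (∁? p∤?) i∈)) (proj₁ (∈-filter⁻ (∁? p∤?) j∈)) i≢j))
    (λ i∈ → let (i∈xs , ¬p∤) = ∈-filter⁻ (∁? p∤?) i∈ in Any.tail ¬p∤ (diagonal i∈xs))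

prime∣prime⇒≡ : ∀ {p r} → Prime p → Prime r → p ∣ r → p ≡ r
prime∣prime⇒≡ p-prime r-prime p∣r with prime⇒irreducible r-prime p∣r
... | inj₁ p≡1 = contradiction p≡1 (nonTrivial⇒≢1 {{prime⇒nonTrivial p-prime}})
... | inj₂ p≡r = p≡r

prime∣product⇒∈ : ∀ {p ps} → Prime p → All Prime ps → p ∣ product ps → p ∈ ps
prime∣product⇒∈ p-prime [] p∣1 = contradiction (∣1⇒≡1 p∣1) (nonTrivial⇒≢1 {{prime⇒nonTrivial p-prime}})
prime∣product⇒∈ {ps = r ∷ ps} p-prime (r-prime ∷ primes) p∣r*rs with euclidsLemma r (product ps) p-prime p∣r*rs
... | inj₁ p∣r  = here (prime∣prime⇒≡ p-prime r-prime p∣r)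
... | inj₂ p∣rs = there (prime∣product⇒∈ p-prime primes p∣rs)

All∣⇒product∣ : ∀ {m ps} → All Prime ps → Unique ps → All (_∣ m) ps → product ps ∣ m
All∣⇒product∣ {m} [] [] [] = 1∣ m
All∣⇒product∣ {ps = p ∷ ps} (p-prime ∷ primes) (p∉ps ∷ distinct) (p∣m ∷ ps∣m)
  with All∣⇒product∣ primes distinct ps∣m
... | divides s refl with euclidsLemma s (product ps) p-prime p∣m
...   | inj₁ (divides s′ refl) = divides s′ (*-assoc s′ p (product ps))
...   | inj₂ p∣ps = contradiction (prime∣product⇒∈ p-prime primes p∣ps) (All¬⇒¬Any p∉ps)

cofactor : (ps : List ℕ) → Fin (length ps) → ℕ
cofactor (p ∷ ps) F.zero    = product ps
cofactor (p ∷ ps) (F.suc j) = p * cofactor ps j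

cofactor*lookup : ∀ ps j → cofactor ps j * lookup ps j ≡ product ps
cofactor*lookup (p ∷ ps) F.zero    = *-comm (product ps) p
cofactor*lookup (p ∷ ps) (F.suc j) = trans (*-assoc p _ _) (cong (p *_) (cofactor*lookup ps j))

lookup∣product : ∀ ps j → lookup ps j ∣ product ps
lookup∣product ps j = ∈⇒∣product (∈-lookup {xs = ps} j)

lookup∣cofactor : ∀ ps {j j′} → j ≢ j′ → lookup ps j ∣ cofactor ps j′
lookup∣cofactor (p ∷ ps) {F.zero}  {F.zero}   j≢j′ = contradiction refl j≢j′
lookup∣cofactor (p ∷ ps) {F.zero}  {F.suc j′} j≢j′ = m∣m*n (cofactor ps j′)
lookup∣cofactor (p ∷ ps) {F.suc j} {F.zero}   j≢j′ = lookup∣product ps j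
lookup∣cofactor (p ∷ ps) {F.suc j} {F.suc j′} j≢j′ =
  ∣n⇒∣m*n p (lookup∣cofactor ps (j≢j′ ∘ cong F.suc))

product∣cofactor*cofactor : ∀ ps {j j′} → j ≢ j′ → product ps ∣ cofactor ps j * cofactor ps j′
product∣cofactor*cofactor ps {j} {j′} j≢j′ =
  subst (_∣ cofactor ps j * cofactor ps j′) (cofactor*lookup ps j) (*-monoʳ-∣ (cofactor ps j) (lookup∣cofactor ps j≢j′))

lookup-prime : ∀ {ps} → All Prime ps → ∀ j → Prime (lookup ps j)
lookup-prime {ps} primes j = All.lookup primes (∈-lookup {xs = ps} j)

lookup∤cofactor : ∀ {ps} → All Prime ps → Unique ps → ∀ j → lookup ps j ∤ cofactor ps j
lookup∤cofactor {p ∷ ps} (p-prime ∷ primes) (p∉ps ∷ _) F.zero p∣ps =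
  All¬⇒¬Any p∉ps (prime∣product⇒∈ p-prime primes p∣ps)
lookup∤cofactor {p ∷ ps} (p-prime ∷ primes) (p∉ps ∷ distinct) (F.suc j) r∣p*c
  with euclidsLemma p (cofactor ps j) (lookup-prime primes j) r∣p*c
... | inj₁ r∣p = All¬⇒¬Any p∉ps (subst (_∈ ps) (prime∣prime⇒≡ (lookup-prime primes j) p-prime r∣p) (∈-lookup {xs = ps} j))
... | inj₂ r∣c = lookup∤cofactor primes distinct j r∣c

product∤cofactor² : ∀ {ps} → All Prime ps → Unique ps → ∀ j → product ps ∤ cofactor ps j * cofactor ps j
product∤cofactor² {ps} primes distinct j ps∣c² = lookup∤cofactor primes distinct j
  (reduce (euclidsLemma _ _ (lookup-prime primes j) (∣-trans (lookup∣product ps j) ps∣c²)))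

cofactor<product : ∀ {ps} → All Prime ps → ∀ j → cofactor ps j < product ps
cofactor<product {ps} primes j = subst (cofactor ps j <_) (cofactor*lookup ps j)
  (m<m*n (cofactor ps j) (lookup ps j) {{cofactor≢0}} (nonTrivial⇒n>1 _ {{prime⇒nonTrivial (lookup-prime primes j)}}))
  where
  cofactor≢0 : NonZero (cofactor ps j)
  cofactor≢0 = m*n≢0⇒m≢0 (cofactor ps j) {{subst NonZero (sym (cofactor*lookup ps j)) (productOfPrimes≢0 primes)}}

NEQ≡true⇔≢ : ∀ {n} {x y : Fin n} → (NEQ n x y ≡ true) ⇔ (x ≢ y)
NEQ≡true⇔≢ {x = x} {y} with x F.≟ y
... | yes x≡y = mk⇔ (λ ()) (λ x≢y → contradiction x≡y x≢y)
... | no  x≢y = mk⇔ (λ _ → x≢y) (λ _ → refl)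

NEQ-encoding⇒n≤k*ℓ : ∀ {n ps ℓ} → All Prime ps → Unique ps →
                     IPEncoding (NEQ n) (product ps) ℓ → n ≤ length ps * ℓ
NEQ-encoding⇒n≤k*ℓ {n} {ps} primes distinct enc =
  subst (_≤ _) (List.length-tabulate id)
    (length≤primes*dimension u v primes (Unique.allFin⁺ n) (λ _ _ → off-diagonal) (λ _ → diagonal))
  where
  open IPEncoding enc
  u v : Fin n → Fin _ → ℕ
  u x = toℕ ∘ encX x
  v y = toℕ ∘ encY y
  off-diagonal : ∀ {x y} → x ≢ y → All (_∣ u x · v y) ps
  off-diagonal {x} {y} x≢y = All.tabulate λ r∈ps →
    ∣-trans (∈⇒∣product r∈ps) (Equivalence.to (correct x y) (Equivalence.from NEQ≡true⇔≢ x≢y))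
  diagonal : ∀ {x} → Any (_∤ u x · v x) ps
  diagonal {x} = ¬All⇒Any¬ (_∣? u x · v x) ps λ all∣ →
    Equivalence.to NEQ≡true⇔≢ (Equivalence.from (correct x x) (All∣⇒product∣ primes distinct all∣)) refl

single : ∀ {ℓ} → Fin ℓ → ℕ → Fin ℓ → ℕ
single F.zero    a F.zero    = a
single F.zero    a (F.suc t) = 0
single (F.suc i) a F.zero    = 0
single (F.suc i) a (F.suc t) = single i a t

single-· : ∀ {ℓ} (i : Fin ℓ) a z → single i a · z ≡ a * z i
single-· {suc ℓ} F.zero    a z = trans (cong (a * z F.zero +_) (sumFin-zero ℓ)) (+-identityʳ _)
single-· {suc ℓ} (F.suc i) a z = single-· i a (z ∘ F.suc)

single-self : ∀ {ℓ} (i : Fin ℓ) a → single i a i ≡ a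
single-self F.zero    a = refl
single-self (F.suc i) a = single-self i a

single-≢ : ∀ {ℓ} {i t : Fin ℓ} a → i ≢ t → single i a t ≡ 0
single-≢ {i = F.zero}  {F.zero}  a i≢t = contradiction refl i≢t
single-≢ {i = F.zero}  {F.suc t} a i≢t = refl
single-≢ {i = F.suc i} {F.zero}  a i≢t = refl
single-≢ {i = F.suc i} {F.suc t} a i≢t = single-≢ a (i≢t ∘ cong F.suc)

single·single-≡ : ∀ {ℓ} (i : Fin ℓ) a b → single i a · single i b ≡ a * b
single·single-≡ i a b = trans (single-· i a (single i b)) (cong (a *_) (single-self i b))

single·single-≢ : ∀ {ℓ} {i i′ : Fin ℓ} a b → i ≢ i′ → single i a · single i′ b ≡ 0
single·single-≢ {i = i} a b i≢i′ =
  trans (single-· i a _) (trans (cong (a *_) (single-≢ b (i≢i′ ∘ sym))) (*-zeroʳ a))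

single≤ : ∀ {ℓ} (i : Fin ℓ) a t → single i a t ≤ a
single≤ F.zero    a F.zero    = ≤-refl
single≤ F.zero    a (F.suc t) = z≤n
single≤ (F.suc i) a F.zero    = z≤n
single≤ (F.suc i) a (F.suc t) = single≤ i a t

orthogonal⇒NEQ-encoding : ∀ {q k} (c : Fin k → ℕ) → (∀ j → c j < q) →
                          (∀ {j j′} → j ≢ j′ → q ∣ c j * c j′) → (∀ j → q ∤ c j * c j) →
                          ∀ {n ℓ} → n ≤ ℓ * k → IPEncoding (NEQ n) q ℓ
orthogonal⇒NEQ-encoding {q} {k} c c<q q∣c*c q∤c² {n} {ℓ} n≤ℓ*k = record
  { encX = encode ; encY = encode ; correct = λ x y → mk⇔ (to x y) (from x y) }
  where
  slot : Fin n → Fin ℓ × Fin k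
  slot x = F.remQuot k (F.inject≤ x n≤ℓ*k)
  slot-injective : ∀ {x y} → slot x ≡ slot y → x ≡ y
  slot-injective {x} {y} eq = FP.inject≤-injective n≤ℓ*k n≤ℓ*k x y (begin
    F.inject≤ x n≤ℓ*k                 ≡⟨ FP.combine-remQuot {ℓ} k _ ⟨
    uncurry F.combine (slot x)        ≡⟨ cong (uncurry F.combine) eq ⟩
    uncurry F.combine (slot y)        ≡⟨ FP.combine-remQuot {ℓ} k _ ⟩
    F.inject≤ y n≤ℓ*k                 ∎)
    where open ≡-Reasoning
  coordinate : Fin n → Fin ℓ
  coordinate = proj₁ ∘ slot
  label : Fin n → Fin k
  label = proj₂ ∘ slot
  codeword : Fin n → Fin ℓ → ℕ
  codeword x = single (coordinate x) (c (label x))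
  codeword<q : ∀ x t → codeword x t < q
  codeword<q x t = ≤-<-trans (single≤ (coordinate x) (c (label x)) t) (c<q (label x))
  encode : Fin n → Fin ℓ → Fin q
  encode x t = F.fromℕ< (codeword<q x t)
  innerProduct≡· : ∀ x y → innerProduct (encode x) (encode y) ≡ codeword x · codeword y
  innerProduct≡· x y = sumFin-cong ℓ λ t →
    cong₂ _*_ (FP.toℕ-fromℕ< (codeword<q x t)) (FP.toℕ-fromℕ< (codeword<q y t))
  codeword-orthogonal : ∀ {x y} → x ≢ y → q ∣ codeword x · codeword y
  codeword-orthogonal {x} {y} x≢y with coordinate x F.≟ coordinate y
  ... | no i≢i′  = subst (q ∣_) (sym (single·single-≢ (c (label x)) (c (label y)) i≢i′)) (q ∣0)
  ... | yes i≡i′ = subst (q ∣_)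
                     (sym (trans (cong (λ i → single i (c (label x)) · codeword y) i≡i′)
                                 (single·single-≡ (coordinate y) (c (label x)) (c (label y)))))
                     (q∣c*c λ j≡j′ → x≢y (slot-injective (cong₂ _,_ i≡i′ j≡j′)))
  codeword-self : ∀ x → q ∤ codeword x · codeword x
  codeword-self x q∣ = q∤c² (label x) (subst (q ∣_) (single·single-≡ (coordinate x) (c (label x)) (c (label x))) q∣)
  to : ∀ x y → NEQ n x y ≡ true → q ∣ innerProduct (encode x) (encode y)
  to x y neq = subst (q ∣_) (sym (innerProduct≡· x y)) (codeword-orthogonal (Equivalence.to NEQ≡true⇔≢ neq))
  from : ∀ x y → q ∣ innerProduct (encode x) (encode y) → NEQ n x y ≡ true
  from x y q∣ = Equivalence.from NEQ≡true⇔≢ λ { refl → codeword-self x (subst (q ∣_) (innerProduct≡· x x) q∣) }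

n≤ceilDiv*k : ∀ n k → n ≤ ceilDiv n (suc k) * suc k
n≤ceilDiv*k n k = +-cancelʳ-≤ k n _ $ begin
  n + k                                                ≡⟨ m≡m%n+[m/n]*n (n + k) (suc k) ⟩
  (n + k) % suc k + ceilDiv n (suc k) * suc k           ≤⟨ +-monoˡ-≤ _ (s≤s⁻¹ (m%n<n (n + k) (suc k))) ⟩
  k + ceilDiv n (suc k) * suc k                         ≡⟨ +-comm k _ ⟩
  ceilDiv n (suc k) * suc k + k                         ∎
  where open ≤-Reasoning

ceilDiv-least : ∀ {n k ℓ} → n ≤ suc k * ℓ → ceilDiv n (suc k) ≤ ℓ
ceilDiv-least {n} {k} {ℓ} n≤k*ℓ = s≤s⁻¹ (m<n*o⇒m/o<n (s≤s (begin
  n + k             ≡⟨ +-comm n k ⟩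
  k + n             ≤⟨ +-monoʳ-≤ k (subst (n ≤_) (*-comm (suc k) ℓ) n≤k*ℓ) ⟩
  k + ℓ * suc k     ∎)))
  where open ≤-Reasoning

mainTheorem4 : (n q k : ℕ) → 1 ≤ n → 1 ≤ k → ProductOfDistinctPrimes q k →
    IsDI (NEQ n) q (ceilDiv n k)
mainTheorem4 n _ _ _ () ([] , refl , _)
mainTheorem4 n _ _ _ _ (ps@(_ ∷ ps′) , refl , primes , distinct , refl) =
    orthogonal⇒NEQ-encoding (cofactor ps) (cofactor<product primes)
      (product∣cofactor*cofactor ps) (product∤cofactor² primes distinct) (n≤ceilDiv*k n (length ps′))
  , λ ℓ enc → ceilDiv-least (NEQ-encoding⇒n≤k*ℓ primes distinct enc)
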